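{- Let $\{a_n\}_{n=0}^\infty$ be a sequence in $\mathbb{C}$ such that $|a_n|>1$ for all $n\geq 1$, and such that for every $n\geq 1$ with $|a_{n+1}|<2$ we have $\left|(|a_{n+1}|^2-1)a_n+\overline{a_{n+1}}\right|\geq |a_{n+1}|^2$. Let $\{p_n\},\{q_n\}$ be the $\mathcal{Q}$-pair of $\{a_n\}$. Then $|q_{n+1}|>|q_n|$ for all $n\geq 1$.
   Context: For a sequence $\{a_n\}_{n\ge0}$ of complex numbers, its $\mathcal{Q}$-pair is defined by $p_{ -1}=1$, $p_0=a_0$, $p_{n+1}=a_{n+1}p_n+p_{n-1}$ and $q_{ -1}=0$, $q_0=1$, $q_{n+1}=a_{n+1}q_n+q_{n-1}$ for all $n\geq 0$. -}

module Defs where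

open import Level using (0ℓ)
open import Data.Nat using (ℕ; zero; suc)
open import Data.Product using (_×_; _,_; proj₁; proj₂; Σ; ∃)
open import Data.Sum using (_⊎_)
open import Relation.Binary.PropositionalEquality using (_≡_)
open import Relation.Nullary using (¬_)
import Algebra.Structures as AS
import Relation.Binary.Structures as RS

-- The real numbers, axiomatised as a complete ordered field
-- (any model is isomorphic to ℝ).  Equality is propositional.
record RealField : Set₁ where
  infixl 6 _+_
  infixl 7 _*_
  infix 4 _<_
  field
    Carrier : Set
    _+_ _*_ : Carrier → Carrier → Carrier
    -_      : Carrier → Carrier
    0# 1#   : Carrier
    isCommutativeRing : AS.IsCommutativeRing {A = Carrier} _≡_ _+_ _*_ -_ 0# 1#
    _<_     : Carrier → Carrier → Set
    isStrictTotalOrder : RS.IsStrictTotalOrder {A = Carrier} _≡_ _<_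
    +-mono-<  : ∀ {x y} z → x < y → x + z < y + z
    *-pos     : ∀ {x y} → 0# < x → 0# < y → 0# < x * y
    inverse   : ∀ x → ¬ (x ≡ 0#) → Σ Carrier (λ y → x * y ≡ 1#)
    complete  : (P : Carrier → Set) → ∃ P →
                ∃ (λ b → ∀ x → P x → (x < b ⊎ x ≡ b)) →
                ∃ (λ s → (∀ x → P x → (x < s ⊎ x ≡ s)) ×
                         (∀ b → (∀ x → P x → (x < b ⊎ x ≡ b)) → (s < b ⊎ s ≡ b)))

module Over (R : RealField) where
  open RealField R public

  infix 4 _≤_
  infixl 6 _-_
  _≤_ : Carrier → Carrier → Set
  x ≤ y = x < y ⊎ x ≡ y

  _-_ : Carrier → Carrier → Carrier
  x - y = x + (- y)

  2# 4# : Carrier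
  2# = 1# + 1#
  4# = 2# * 2#

  -- complex numbers as pairs (real part, imaginary part)
  ℂ : Set
  ℂ = Carrier × Carrier

  0ℂ 1ℂ : ℂ
  0ℂ = 0# , 0#
  1ℂ = 1# , 0#

  _+ℂ_ : ℂ → ℂ → ℂ
  (x , y) +ℂ (u , v) = (x + u) , (y + v)

  _*ℂ_ : ℂ → ℂ → ℂ
  (x , y) *ℂ (u , v) = (x * u - y * v) , (x * v + y * u)

  conj : ℂ → ℂ
  conj (x , y) = x , - y

  ofReal : Carrier → ℂ
  ofReal r = r , 0#

  normSq : ℂ → Carrier
  normSq (x , y) = x * x + y * y

  -- Q-pair: index n of these gives (p_{n-1}, p_n) and (q_{n-1}, q_n)
  pPair : (ℕ → ℂ) → ℕ → ℂ × ℂ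
  pPair a zero = 1ℂ , a 0
  pPair a (suc n) = proj₂ (pPair a n) , (a (suc n) *ℂ proj₂ (pPair a n)) +ℂ proj₁ (pPair a n)

  qPair : (ℕ → ℂ) → ℕ → ℂ × ℂ
  qPair a zero = 0ℂ , 1ℂ
  qPair a (suc n) = proj₂ (qPair a n) , (a (suc n) *ℂ proj₂ (qPair a n)) +ℂ proj₁ (qPair a n)

  p q : (ℕ → ℂ) → ℕ → ℂ
  p a n = proj₂ (pPair a n)
  q a n = proj₂ (qPair a n)

module Submission where

-- Everything is phrased with squared moduli, so no square roots are needed.
-- The proof is an induction showing |qₘ₋₁| < |qₘ| for all m, where the step
-- Q' = aQ + P (with P = qₘ₋₁, Q = qₘ = bP + S, S = qₘ₋₂) splits on |a|:
--   * |a| ≥ 2: the growth lemma with t = 1 gives |Q| < |aQ + P| from |P| < |Q|;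
--   * |a| < 2: the norm recurrence (|a|² - 1)(|Q'|² - |Q|²) = |wP + cS|² - |P|²,
--     with c = |a|² - 1 and w = cb + ā, reduces the claim to the growth lemma
--     with t = c, which applies because |w|² ≥ |a|⁴ = (c + 1)² and |S| < |P|.
-- The growth lemma (|wX + tY| > |X| when t > 0, |w| ≥ t + 1, |Y| < |X|) follows
-- from a polynomial identity with a manifestly positive right-hand side.

open import Defs
open import Level using (0ℓ)
open import Data.Nat as ℕ using (ℕ; zero; suc; s≤s; z≤n) renaming (_≤_ to _≤ℕ_)
open import Data.Integer as ℤ using (ℤ; -[1+_])
import Data.Integer.Properties as ℤₚ
import Data.Nat.Properties as ℕₚ
open import Data.Maybe using (Maybe; just; nothing)
open import Relation.Binary.PropositionalEquality
open import Relation.Nullary using (yes; no)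
open import Algebra.Bundles using (CommutativeRing)
open import Data.Product using (proj₁; proj₂)
import Algebra.Solver.Ring.AlmostCommutativeRing as ACR

-- A ring solver for the real field R with integer coefficients: the
-- normaliser compares coefficients in ℤ, where equality is decidable by
-- computation, and interprets them in R through the canonical ring map.
module IntegerSolver (R : RealField) where
  open Over R

  commutativeRing : CommutativeRing 0ℓ 0ℓ
  commutativeRing = record { isCommutativeRing = isCommutativeRing }

  open CommutativeRing commutativeRing
    using (+-assoc; +-comm; +-identityˡ; +-identityʳ; *-identityˡ; zeroˡ; distribʳ; -‿inverseʳ;
           ring; semiring; +-abelianGroup; +-group)
  open import Algebra.Properties.Ring ring using (-‿distribˡ-*)
  open import Algebra.Properties.AbelianGroup +-abelianGroup using (⁻¹-∙-comm)
  open import Algebra.Properties.Group +-group using (⁻¹-involutive; ε⁻¹≈ε)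
  open import Algebra.Properties.Semiring.Mult.TCOptimised semiring using (_×_; 1+×; ×-homo-+)
  open ≡-Reasoning

  -- The canonical ring map ℤ → R, using the type-checking-friendly
  -- multiplication by naturals so that ⟦ 1 ⟧ℤ is definitionally 1#.
  ⟦_⟧ℤ : ℤ → Carrier
  ⟦ ℤ.+ n ⟧ℤ      = n × 1#
  ⟦ -[1+ n ] ⟧ℤ = - (suc n × 1#)

  x-0≡x : ∀ x → x - 0# ≡ x
  x-0≡x x = trans (cong (x +_) ε⁻¹≈ε) (+-identityʳ x)

  1+x-[1+y]≡x-y : ∀ x y → (1# + x) - (1# + y) ≡ x - y
  1+x-[1+y]≡x-y x y = begin
    (1# + x) + - (1# + y)   ≡⟨ cong₂ _+_ (+-comm 1# x) (sym (⁻¹-∙-comm 1# y)) ⟩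
    (x + 1#) + (- 1# + - y) ≡⟨ +-assoc x 1# _ ⟩
    x + (1# + (- 1# + - y)) ≡⟨ cong (x +_) (sym (+-assoc 1# (- 1#) (- y))) ⟩
    x + ((1# + - 1#) + - y) ≡⟨ cong (λ z → x + (z + - y)) (-‿inverseʳ 1#) ⟩
    x + (0# + - y)          ≡⟨ cong (x +_) (+-identityˡ (- y)) ⟩
    x + - y                 ∎

  ⊖-homo : ∀ m n → ⟦ m ℤ.⊖ n ⟧ℤ ≡ m × 1# - n × 1#
  ⊖-homo m       zero    = sym (x-0≡x (m × 1#))
  ⊖-homo zero    (suc n) = sym (+-identityˡ _)
  ⊖-homo (suc m) (suc n) = begin
    ⟦ suc m ℤ.⊖ suc n ⟧ℤ         ≡⟨ cong ⟦_⟧ℤ (ℤₚ.[1+m]⊖[1+n]≡m⊖n m n) ⟩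
    ⟦ m ℤ.⊖ n ⟧ℤ                 ≡⟨ ⊖-homo m n ⟩
    m × 1# - n × 1#              ≡⟨ 1+x-[1+y]≡x-y _ _ ⟨
    (1# + m × 1#) - (1# + n × 1#) ≡⟨ cong₂ _-_ (1+× m 1#) (1+× n 1#) ⟨
    suc m × 1# - suc n × 1#      ∎

  +-homo : ∀ i j → ⟦ i ℤ.+ j ⟧ℤ ≡ ⟦ i ⟧ℤ + ⟦ j ⟧ℤ
  +-homo (ℤ.+ m)    (ℤ.+ n)    = ×-homo-+ 1# m n
  +-homo (ℤ.+ m)    -[1+ n ] = ⊖-homo m (suc n)
  +-homo -[1+ m ] (ℤ.+ n)    = trans (⊖-homo n (suc m)) (+-comm _ _)
  +-homo -[1+ m ] -[1+ n ] = begin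
    - (suc (suc (m ℕ.+ n)) × 1#)          ≡⟨ cong (λ k → - (suc k × 1#)) (ℕₚ.+-suc m n) ⟨
    - ((suc m ℕ.+ suc n) × 1#)            ≡⟨ cong -_ (×-homo-+ 1# (suc m) (suc n)) ⟩
    - (suc m × 1# + suc n × 1#)           ≡⟨ ⁻¹-∙-comm _ _ ⟨
    - (suc m × 1#) + - (suc n × 1#)       ∎

  neg-homo : ∀ i → ⟦ ℤ.- i ⟧ℤ ≡ - ⟦ i ⟧ℤ
  neg-homo (ℤ.+ zero)    = sym ε⁻¹≈ε
  neg-homo (ℤ.+ suc n)   = refl
  neg-homo -[1+ n ]    = sym (⁻¹-involutive _)

  *-homo-+ : ∀ n j → ⟦ ℤ.+ n ℤ.* j ⟧ℤ ≡ n × 1# * ⟦ j ⟧ℤ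
  *-homo-+ zero    j = sym (zeroˡ ⟦ j ⟧ℤ)
  *-homo-+ (suc n) j = begin
    ⟦ ℤ.+ suc n ℤ.* j ⟧ℤ              ≡⟨ cong ⟦_⟧ℤ (ℤₚ.*-distribʳ-+ j (ℤ.+ 1) (ℤ.+ n)) ⟩
    ⟦ ℤ.+ 1 ℤ.* j ℤ.+ ℤ.+ n ℤ.* j ⟧ℤ    ≡⟨ +-homo (ℤ.+ 1 ℤ.* j) (ℤ.+ n ℤ.* j) ⟩
    ⟦ ℤ.+ 1 ℤ.* j ⟧ℤ + ⟦ ℤ.+ n ℤ.* j ⟧ℤ ≡⟨ cong₂ _+_ (cong ⟦_⟧ℤ (ℤₚ.*-identityˡ j)) (*-homo-+ n j) ⟩
    ⟦ j ⟧ℤ + n × 1# * ⟦ j ⟧ℤ        ≡⟨ cong (_+ n × 1# * ⟦ j ⟧ℤ) (*-identityˡ _) ⟨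
    1# * ⟦ j ⟧ℤ + n × 1# * ⟦ j ⟧ℤ   ≡⟨ distribʳ _ _ _ ⟨
    (1# + n × 1#) * ⟦ j ⟧ℤ          ≡⟨ cong (_* ⟦ j ⟧ℤ) (1+× n 1#) ⟨
    suc n × 1# * ⟦ j ⟧ℤ             ∎

  *-homo : ∀ i j → ⟦ i ℤ.* j ⟧ℤ ≡ ⟦ i ⟧ℤ * ⟦ j ⟧ℤ
  *-homo (ℤ.+ n)    j = *-homo-+ n j
  *-homo -[1+ n ] j = begin
    ⟦ ℤ.- ℤ.+ suc n ℤ.* j ⟧ℤ       ≡⟨ cong ⟦_⟧ℤ (ℤₚ.neg-distribˡ-* (ℤ.+ suc n) j) ⟨
    ⟦ ℤ.- (ℤ.+ suc n ℤ.* j) ⟧ℤ     ≡⟨ neg-homo (ℤ.+ suc n ℤ.* j) ⟩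
    - ⟦ ℤ.+ suc n ℤ.* j ⟧ℤ         ≡⟨ cong -_ (*-homo-+ (suc n) j) ⟩
    - (suc n × 1# * ⟦ j ⟧ℤ)      ≡⟨ -‿distribˡ-* _ _ ⟩
    - (suc n × 1#) * ⟦ j ⟧ℤ      ∎

  integerMorphism : ACR._-Raw-AlmostCommutative⟶_ ℤ.+-*-rawRing (ACR.fromCommutativeRing commutativeRing)
  integerMorphism = record
    { ⟦_⟧ = ⟦_⟧ℤ ; +-homo = +-homo ; *-homo = *-homo ; -‿homo = neg-homo
    ; 0-homo = refl ; 1-homo = refl }

  coefficientEquality : ∀ i j → Maybe (⟦ i ⟧ℤ ≡ ⟦ j ⟧ℤ)
  coefficientEquality i j with i ℤ.≟ j
  ... | yes refl = just refl
  ... | no _     = nothing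

  open import Algebra.Solver.Ring ℤ.+-*-rawRing (ACR.fromCommutativeRing commutativeRing)
    integerMorphism coefficientEquality public

  0′ 1′ : ∀ {n} → Polynomial n
  0′ = con (ℤ.+ 0)
  1′ = con (ℤ.+ 1)

-- Complex arithmetic on solver expressions, mirroring the operations of
-- Over R componentwise, so that an identity between complex expressions
-- becomes a polynomial identity between their real and imaginary parts.
module ComplexIdentities (R : RealField) where
  open Over R
  open IntegerSolver R
  open import Data.Product using (_×_; _,_; proj₁; proj₂)

  private
    infixl 6 _⊕_
    infixl 7 _⊗_

    ℂExpr : ℕ → Set
    ℂExpr n = Polynomial n × Polynomial n

    _⊕_ _⊗_ : ∀ {n} → ℂExpr n → ℂExpr n → ℂExpr n
    (x , y) ⊕ (u , v) = (x :+ u) , (y :+ v)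
    (x , y) ⊗ (u , v) = (x :* u :- y :* v) , (x :* v :+ y :* u)

    conj′ : ∀ {n} → ℂExpr n → ℂExpr n
    conj′ (x , y) = x , :- y

    real′ : ∀ {n} → Polynomial n → ℂExpr n
    real′ r = r , 0′

    normSq′ : ∀ {n} → ℂExpr n → Polynomial n
    normSq′ (x , y) = x :* x :+ y :* y

  growth-identity : ∀ t w X Y →
    (t + 1#) * (normSq ((w *ℂ X) +ℂ (ofReal t *ℂ Y)) - normSq X)
      ≡ t * (t + 1#) * (normSq X - normSq Y)
        + (normSq w - (t + 1#) * (t + 1#)) * normSq X
        + t * normSq ((w *ℂ X) +ℂ (ofReal (t + 1#) *ℂ Y))
  growth-identity t (w₁ , w₂) (x₁ , x₂) (y₁ , y₂) =
    solve 7 (λ t w₁ w₂ x₁ x₂ y₁ y₂ →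
      let w = (w₁ , w₂) ; X = (x₁ , x₂) ; Y = (y₁ , y₂) ; T = t :+ 1′ in
      T :* (normSq′ (w ⊗ X ⊕ real′ t ⊗ Y) :- normSq′ X)
        := t :* T :* (normSq′ X :- normSq′ Y)
           :+ (normSq′ w :- T :* T) :* normSq′ X
           :+ t :* normSq′ (w ⊗ X ⊕ real′ T ⊗ Y))
      refl t w₁ w₂ x₁ x₂ y₁ y₂

  norm-recurrence : ∀ a Q P →
    (normSq a - 1#) * (normSq ((a *ℂ Q) +ℂ P) - normSq Q)
      ≡ normSq ((ofReal (normSq a - 1#) *ℂ Q) +ℂ (conj a *ℂ P)) - normSq P
  norm-recurrence (a₁ , a₂) (q₁ , q₂) (p₁ , p₂) =
    solve 6 (λ a₁ a₂ q₁ q₂ p₁ p₂ →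
      let a = (a₁ , a₂) ; Q = (q₁ , q₂) ; P = (p₁ , p₂) ; c = normSq′ a :- 1′ in
      c :* (normSq′ (a ⊗ Q ⊕ P) :- normSq′ Q)
        := normSq′ (real′ c ⊗ Q ⊕ conj′ a ⊗ P) :- normSq′ P)
      refl a₁ a₂ q₁ q₂ p₁ p₂

  regroup : ∀ c a b P S →
    (ofReal c *ℂ ((b *ℂ P) +ℂ S)) +ℂ (conj a *ℂ P)
      ≡ (((ofReal c *ℂ b) +ℂ conj a) *ℂ P) +ℂ (ofReal c *ℂ S)
  regroup c (a₁ , a₂) (b₁ , b₂) (p₁ , p₂) (s₁ , s₂) = cong₂ _,_
    (solve 9 (λ c a₁ a₂ b₁ b₂ p₁ p₂ s₁ s₂ →
       proj₁ (lhs c (a₁ , a₂) (b₁ , b₂) (p₁ , p₂) (s₁ , s₂))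
         := proj₁ (rhs c (a₁ , a₂) (b₁ , b₂) (p₁ , p₂) (s₁ , s₂)))
      refl c a₁ a₂ b₁ b₂ p₁ p₂ s₁ s₂)
    (solve 9 (λ c a₁ a₂ b₁ b₂ p₁ p₂ s₁ s₂ →
       proj₂ (lhs c (a₁ , a₂) (b₁ , b₂) (p₁ , p₂) (s₁ , s₂))
         := proj₂ (rhs c (a₁ , a₂) (b₁ , b₂) (p₁ , p₂) (s₁ , s₂)))
      refl c a₁ a₂ b₁ b₂ p₁ p₂ s₁ s₂)
    where
      lhs rhs : ∀ {n} → Polynomial n → (a b P S : ℂExpr n) → ℂExpr n
      lhs c a b P S = real′ c ⊗ (b ⊗ P ⊕ S) ⊕ conj′ a ⊗ P
      rhs c a b P S = (real′ c ⊗ b ⊕ conj′ a) ⊗ P ⊕ real′ c ⊗ S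

  ofReal1*z≡z : ∀ z → ofReal 1# *ℂ z ≡ z
  ofReal1*z≡z (x , y) = cong₂ _,_
    (solve 2 (λ x y → 1′ :* x :- 0′ :* y := x) refl x y)
    (solve 2 (λ x y → 1′ :* y :+ 0′ :* x := y) refl x y)

  normSq0ℂ≡0 : normSq 0ℂ ≡ 0#
  normSq0ℂ≡0 = solve 0 (0′ :* 0′ :+ 0′ :* 0′ := 0′) refl

  normSq1ℂ≡1 : normSq 1ℂ ≡ 1#
  normSq1ℂ≡1 = solve 0 (1′ :* 1′ :+ 0′ :* 0′ := 1′) refl

  z*1+0≡z : ∀ z → (z *ℂ 1ℂ) +ℂ 0ℂ ≡ z
  z*1+0≡z (x , y) = cong₂ _,_
    (solve 2 (λ x y → x :* 1′ :- y :* 0′ :+ 0′ := x) refl x y)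
    (solve 2 (λ x y → x :* 0′ :+ y :* 1′ :+ 0′ := y) refl x y)

  x-1+1≡x : ∀ x → (x - 1#) + 1# ≡ x
  x-1+1≡x = solve 1 (λ x → x :- 1′ :+ 1′ := x) refl

module OrderFacts (R : RealField) where
  open Over R
  open IntegerSolver R using (solve; _:=_; _:+_; _:-_; _:*_; :-_; 0′; 1′)
  open import Data.Product using (_,_)
  open import Data.Sum using (inj₁; inj₂)
  open import Data.Empty using (⊥-elim)
  open import Relation.Nullary using (¬_)
  open import Relation.Binary.Definitions using (tri<; tri≈; tri>)
  open import Relation.Binary.Structures using (IsStrictTotalOrder)
  open IsStrictTotalOrder isStrictTotalOrder public using (compare) renaming (trans to <-trans)
  open IsStrictTotalOrder isStrictTotalOrder using (irrefl)

  <-irrefl : ∀ {x} → ¬ (x < x)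
  <-irrefl = irrefl refl

  ≤-<-trans : ∀ {x y z} → x ≤ y → y < z → x < z
  ≤-<-trans (inj₁ x<y)  y<z = <-trans x<y y<z
  ≤-<-trans (inj₂ refl) y<z = y<z

  x<y⇒0<y-x : ∀ {x y} → x < y → 0# < y - x
  x<y⇒0<y-x {x} {y} x<y =
    subst (_< y - x) (solve 1 (λ x → x :- x := 0′) refl x) (+-mono-< (- x) x<y)

  0<y-x⇒x<y : ∀ {x y} → 0# < y - x → x < y
  0<y-x⇒x<y {x} {y} 0<y-x =
    subst₂ _<_ (solve 1 (λ x → 0′ :+ x := x) refl x)
               (solve 2 (λ x y → y :- x :+ x := y) refl x y)
               (+-mono-< x 0<y-x)

  x≤y⇒0≤y-x : ∀ {x y} → x ≤ y → 0# ≤ y - x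
  x≤y⇒0≤y-x (inj₁ x<y)      = inj₁ (x<y⇒0<y-x x<y)
  x≤y⇒0≤y-x {x} (inj₂ refl) = inj₂ (solve 1 (λ x → 0′ := x :- x) refl x)

  x<0⇒0<-x : ∀ {x} → x < 0# → 0# < - x
  x<0⇒0<-x {x} x<0 = subst (0# <_) (solve 1 (λ x → 0′ :- x := :- x) refl x) (x<y⇒0<y-x x<0)

  +-pos-nonneg : ∀ {x y} → 0# < x → 0# ≤ y → 0# < x + y
  +-pos-nonneg {x} {y} 0<x 0≤y =
    ≤-<-trans (subst (0# ≤_) (solve 1 (λ y → y := 0′ :+ y) refl y) 0≤y) (+-mono-< y 0<x)

  +-nonneg : ∀ {x y} → 0# ≤ x → 0# ≤ y → 0# ≤ x + y
  +-nonneg (inj₁ 0<x)      0≤y = inj₁ (+-pos-nonneg 0<x 0≤y)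
  +-nonneg {y = y} (inj₂ refl) 0≤y = subst (0# ≤_) (solve 1 (λ y → y := 0′ :+ y) refl y) 0≤y

  *-nonneg : ∀ {x y} → 0# ≤ x → 0# ≤ y → 0# ≤ x * y
  *-nonneg (inj₁ 0<x) (inj₁ 0<y) = inj₁ (*-pos 0<x 0<y)
  *-nonneg {x} (inj₁ _) (inj₂ refl) = inj₂ (solve 1 (λ x → 0′ := x :* 0′) refl x)
  *-nonneg {y = y} (inj₂ refl) _    = inj₂ (solve 1 (λ y → 0′ := 0′ :* y) refl y)

  square-nonneg : ∀ x → 0# ≤ x * x
  square-nonneg x with compare 0# x
  ... | tri< 0<x _ _    = inj₁ (*-pos 0<x 0<x)
  ... | tri≈ _ refl _   = inj₂ (solve 0 (0′ := 0′ :* 0′) refl)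
  ... | tri> _ _ x<0    = inj₁ (subst (0# <_) (solve 1 (λ x → :- x :* :- x := x :* x) refl x)
                                      (*-pos (x<0⇒0<-x x<0) (x<0⇒0<-x x<0)))

  normSq-nonneg : ∀ z → 0# ≤ normSq z
  normSq-nonneg (x , y) = +-nonneg (square-nonneg x) (square-nonneg y)

  pos-factor : ∀ {k g} → 0# < k → 0# < k * g → 0# < g
  pos-factor {k} {g} 0<k 0<kg with compare 0# g
  ... | tri< 0<g _ _  = 0<g
  ... | tri≈ _ refl _ = ⊥-elim (<-irrefl (subst (0# <_) (solve 1 (λ k → k :* 0′ := 0′) refl k) 0<kg))
  ... | tri> _ _ g<0  = ⊥-elim (<-irrefl (subst (0# <_) (solve 2 (λ k g → k :* g :+ k :* (:- g) := 0′) refl k g)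
                                           (+-pos-nonneg 0<kg (inj₁ (*-pos 0<k (x<0⇒0<-x g<0))))))

  -- In a nontrivial ordered field, 1 is positive.
  0<1 : ∀ {x y} → x < y → 0# < 1#
  0<1 {x} {y} x<y with compare 0# 1#
  ... | tri< 1>0 _ _ = 1>0
  ... | tri≈ _ 0≡1 _ = ⊥-elim (<-irrefl (subst₂ _<_ (collapse x) (collapse y) x<y))
    where
      collapse : ∀ z → z ≡ 0#
      collapse z = begin
        z      ≡⟨ solve 1 (λ z → z := z :* 1′) refl z ⟩
        z * 1# ≡⟨ cong (z *_) 0≡1 ⟨
        z * 0# ≡⟨ solve 1 (λ z → z :* 0′ := 0′) refl z ⟩
        0#     ∎
        where open ≡-Reasoning
  ... | tri> _ _ 1<0 = ⊥-elim (<-irrefl (<-trans 1<0 0<[-1]²))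
    where
      0<[-1]² : 0# < 1#
      0<[-1]² = subst (0# <_) (solve 0 (:- 1′ :* :- 1′ := 1′) refl) (*-pos (x<0⇒0<-x 1<0) (x<0⇒0<-x 1<0))

module Growth (R : RealField) where
  open Over R
  open OrderFacts R
  open ComplexIdentities R
  open import Data.Sum using (inj₁; inj₂)
  open import Relation.Binary.Definitions using (tri<; tri≈; tri>)

  -- Growth lemma: if t > 0, |w| ≥ t + 1 and |Y| < |X|, then |wX + tY| > |X|.
  -- (By the triangle inequality |wX + tY| ≥ (t + 1)|X| - t|Y|; here it is
  -- read off from growth-identity, whose right-hand side is positive.)
  growth : ∀ t w X Y → 0# < t → (t + 1#) * (t + 1#) ≤ normSq w → normSq Y < normSq X →
           normSq X < normSq ((w *ℂ X) +ℂ (ofReal t *ℂ Y))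
  growth t w X Y 0<t T²≤|w|² |Y|<|X| =
    0<y-x⇒x<y (pos-factor 0<T (subst (0# <_) (sym (growth-identity t w X Y)) 0<rhs))
    where
      0<T : 0# < t + 1#
      0<T = +-pos-nonneg 0<t (inj₁ (0<1 |Y|<|X|))
      0<rhs : 0# < t * (t + 1#) * (normSq X - normSq Y)
                     + (normSq w - (t + 1#) * (t + 1#)) * normSq X
                     + t * normSq ((w *ℂ X) +ℂ (ofReal (t + 1#) *ℂ Y))
      0<rhs = +-pos-nonneg
                (+-pos-nonneg (*-pos (*-pos 0<t 0<T) (x<y⇒0<y-x |Y|<|X|))
                              (*-nonneg (x≤y⇒0≤y-x T²≤|w|²) (normSq-nonneg X)))
                (*-nonneg (inj₁ 0<t) (normSq-nonneg _))

  large-step : ∀ a Q P → 4# ≤ normSq a → normSq P < normSq Q →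
               normSq Q < normSq ((a *ℂ Q) +ℂ P)
  large-step a Q P 4≤|a|² |P|<|Q| =
    subst (λ z → normSq Q < normSq ((a *ℂ Q) +ℂ z)) (ofReal1*z≡z P)
          (growth 1# a Q P (0<1 |P|<|Q|) 4≤|a|² |P|<|Q|)

  -- By the norm recurrence
  -- this is the growth lemma for w = (|a|² - 1)b + ā and t = |a|² - 1.
  small-step : ∀ a b P S → 1# < normSq a →
               normSq a * normSq a ≤ normSq ((ofReal (normSq a - 1#) *ℂ b) +ℂ conj a) →
               normSq S < normSq P →
               normSq ((b *ℂ P) +ℂ S) < normSq ((a *ℂ ((b *ℂ P) +ℂ S)) +ℂ P)
  small-step a b P S 1<|a|² |a|⁴≤|w|² |S|<|P| =
    0<y-x⇒x<y (pos-factor 0<c (subst (0# <_) (sym recurrence) (x<y⇒0<y-x grows)))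
    where
      c : Carrier
      c = normSq a - 1#
      w Q : ℂ
      w = (ofReal c *ℂ b) +ℂ conj a
      Q = (b *ℂ P) +ℂ S
      0<c : 0# < c
      0<c = x<y⇒0<y-x 1<|a|²
      recurrence : c * (normSq ((a *ℂ Q) +ℂ P) - normSq Q) ≡ normSq ((w *ℂ P) +ℂ (ofReal c *ℂ S)) - normSq P
      recurrence = trans (norm-recurrence a Q P) (cong (λ z → normSq z - normSq P) (regroup c a b P S))
      grows : normSq P < normSq ((w *ℂ P) +ℂ (ofReal c *ℂ S))
      grows = growth c w P S 0<c (subst (λ s → s * s ≤ normSq w) (sym (x-1+1≡x (normSq a))) |a|⁴≤|w|²) |S|<|P|

  step : ∀ a b P S → 1# < normSq a →
         (normSq a < 4# → normSq a * normSq a ≤ normSq ((ofReal (normSq a - 1#) *ℂ b) +ℂ conj a)) →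
         normSq S < normSq P → normSq P < normSq ((b *ℂ P) +ℂ S) →
         normSq ((b *ℂ P) +ℂ S) < normSq ((a *ℂ ((b *ℂ P) +ℂ S)) +ℂ P)
  step a b P S 1<|a|² small⇒cond |S|<|P| |P|<|Q| with compare (normSq a) 4#
  ... | tri< |a|²<4 _ _ = small-step a b P S 1<|a|² (small⇒cond |a|²<4) |S|<|P|
  ... | tri≈ _ |a|²≡4 _ = large-step a _ P (inj₂ (sym |a|²≡4)) |P|<|Q|
  ... | tri> _ _ 4<|a|² = large-step a _ P (inj₁ 4<|a|²) |P|<|Q|

theorem3p2 : (R : RealField) → let open Over R in
    (a : ℕ → ℂ) →
    (∀ n → 1 ≤ℕ n → 1# < normSq (a n)) →
    (∀ n → 1 ≤ℕ n → normSq (a (suc n)) < 4# →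
      normSq (a (suc n)) * normSq (a (suc n))
        ≤ normSq ((ofReal (normSq (a (suc n)) - 1#) *ℂ a n) +ℂ conj (a (suc n)))) →
    ∀ n → 1 ≤ℕ n → normSq (q a n) < normSq (q a (suc n))
theorem3p2 R a 1<|aₙ|² small⇒cond n _ = consecutive (suc n)
  where
    open Over R
    open OrderFacts R using (0<1)
    open ComplexIdentities R using (normSq0ℂ≡0; normSq1ℂ≡1; z*1+0≡z)
    open Growth R using (step)

    1<|a₁|² : 1# < normSq (a 1)
    1<|a₁|² = 1<|aₙ|² 1 (s≤s z≤n)

    -- Invariant: |q_{m-1}| < |q_m| for every m ≥ 0; the step uses two predecessors.
    consecutive : ∀ m → normSq (proj₁ (qPair a m)) < normSq (proj₂ (qPair a m))
    consecutive zero          = subst₂ _<_ (sym normSq0ℂ≡0) (sym normSq1ℂ≡1) (0<1 1<|a₁|²)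
    consecutive (suc zero)    = subst₂ _<_ (sym normSq1ℂ≡1) (cong normSq (sym (z*1+0≡z (a 1)))) 1<|a₁|²
    consecutive (suc (suc k)) =
      step (a (suc (suc k))) (a (suc k)) (proj₂ (qPair a k)) (proj₁ (qPair a k))
           (1<|aₙ|² (suc (suc k)) (s≤s z≤n)) (small⇒cond (suc k) (s≤s z≤n))
           (consecutive k) (consecutive (suc k))
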